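{- Let $0 \le p < q$ be integers and let $n \ge \max(p,1)$. Let $F_n^{p,q}$ be the set of words $\omega = \omega_1\omega_2\cdots\omega_n$ of nonnegative integers such that: (a) $\omega_1 = 0$ and $\omega_i = i-1$ for all $1 \le i \le p$; (b) $0 \le \omega_{i+1} \le \omega_i + 1$ for all $1 \le i \le n-1$; (c) for every $i$ with $p+1 \le i \le n$, if $\omega_i = 0$ then $i \le n-q+1$ and $\omega_{i+1}\omega_{i+2}\cdots\omega_{i+q-1} = 1\,2\,\cdots\,(q-1)$. Then $$|F_n^{p,q}| = \sum_{k=0}^{\lfloor (n-p)/q \rfloor} \left[ \binom{2n-(kq+p)-1}{n-1} - \binom{2n-(kq+p)-1}{n} \right].$$
   Context: The words in $F_n^{p,q}$ are called generalized Fine sequences (congruous $p$ modulo $q$). For a positive integer $r$, the quantity $\binom{2n-r-1}{n-1}-\binom{2n-r-1}{n}$ is the number of Dyck (Catalan) paths of semilength $n$ whose first rise has height exactly $r$. -}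

module Defs where

open import Data.Nat using (ℕ; zero; suc; _+_; _*_; _∸_; _≤_; _<_)
open import Data.Nat.Combinatorics using (_C_)
open import Data.Fin using (Fin; toℕ)
open import Data.Vec using (Vec; lookup)
open import Data.List using (List; length; map; foldr; upTo)
open import Data.List.Membership.Propositional using (_∈_)
open import Data.List.Relation.Unary.Unique.Propositional using (Unique)
open import Data.Integer using (ℤ; +_) renaming (_+_ to _+ℤ_; _-_ to _-ℤ_)
open import Data.Product using (Σ; _×_)
open import Relation.Binary.PropositionalEquality using (_≡_)
open import Function.Bundles using (_⇔_)

-- Words ω = ω₁ … ωₙ are vectors; position i (1-based) is the Fin index j with toℕ j = i - 1.

record FineWord (p q n : ℕ) (ω : Vec ℕ n) : Set where
  field
    first-zero : ∀ (j : Fin n) → toℕ j ≡ 0 → lookup ω j ≡ 0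
    prefix : ∀ (j : Fin n) → toℕ j < p → lookup ω j ≡ toℕ j
    -- (b) 0 ≤ ω_{i+1} ≤ ω_i + 1 (nonnegativity is automatic in ℕ)
    step : ∀ (j k : Fin n) → toℕ k ≡ suc (toℕ j) → lookup ω k ≤ suc (lookup ω j)
    zero-cond : ∀ (j : Fin n) → p ≤ toℕ j → lookup ω j ≡ 0 →
      (toℕ j + q ≤ n) ×
      (∀ (k : Fin n) → toℕ j < toℕ k → toℕ k < toℕ j + q → lookup ω k ≡ toℕ k ∸ toℕ j)

HasCard : {A : Set} → (A → Set) → ℕ → Set
HasCard {A} P N = Σ (List A) λ xs → Unique xs × (∀ x → (x ∈ xs) ⇔ P x) × (length xs ≡ N)

sumℤ : List ℤ → ℤ
sumℤ = foldr _+ℤ_ (+ 0)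

term : (p q n k : ℕ) → ℤ
term p q n k = (+ (m C (n ∸ 1))) -ℤ (+ (m C n))
  where m = (2 * n) ∸ (k * q + p) ∸ 1

-- Reading a Fine word letter by letter, what may follow depends only on the largest admissible
-- next letter w and on the number d of letters still forced (by the prefix, or by a preceding 0).
-- This is an unambiguous grammar, so the words are listed without repetition by an enumeration
-- whose lengths obey the recursions obtained by splitting on the first letter.  The sums
-- Σₖ ballot (M + W) (k q + W) obey the same recursions, because ballot numbers satisfy a Pascal
-- rule and vanish beyond the diagonal.
module Submission where

open import Defs
open import Data.Nat using (ℕ; zero; suc; _+_; _*_; _∸_; _≤_; _<_; _⊔_; z≤n; s≤s; s≤s⁻¹; z<s; s<s; 2+; NonZero)
open import Data.Nat.Properties
open import Data.Nat.Combinatorics using (_C_; nCk≡nC[n∸k]; nCn≡1; nCk+nC[k+1]≡[n+1]C[k+1]; k>n⇒nCk≡0)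
open import Data.Nat.DivMod using (_/_; m/n≡1+[m∸n]/n; m<n⇒m/n≡0; m/n*n≤m; /-monoˡ-≤; m*n/n≡m)
open import Data.Integer using (ℤ; +_) renaming (_+_ to _+ℤ_; _-_ to _-ℤ_)
import Data.Integer.Properties as ℤ
open import Data.Integer.Tactic.RingSolver using (solve-∀)
open import Data.Fin using (Fin; toℕ; zero; suc)
open import Data.Vec using (Vec; []; _∷_; lookup)
open import Data.Vec.Properties using (∷-injectiveʳ)
open import Data.List using (List; map; upTo; applyUpTo; length; _++_) renaming ([] to []ᴸ; _∷_ to _∷ᴸ_)
open import Data.List.Properties using (map-applyUpTo; length-map; length-++)
open import Data.List.Membership.Propositional using (_∈_)
open import Data.List.Membership.Propositional.Properties using (∈-map⁺; ∈-map⁻; ∈-++⁺ˡ; ∈-++⁺ʳ; ∈-++⁻)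
open import Data.List.Relation.Unary.Any using (here)
open import Data.List.Relation.Unary.Unique.Propositional using (Unique)
import Data.List.Relation.Unary.Unique.Propositional.Properties as Unique
import Data.List.Relation.Unary.AllPairs as AllPairs
import Data.List.Relation.Unary.All as All
open import Data.List.Relation.Binary.Disjoint.Propositional using (Disjoint)
open import Data.Product using (Σ; _×_; _,_; proj₁; proj₂)
open import Data.Sum using (inj₁; inj₂)
open import Data.Empty using (⊥-elim)
open import Function.Bundles using (_⇔_; mk⇔)
open import Relation.Binary.PropositionalEquality

ballot : ℕ → ℕ → ℤ
ballot n r = + (m C (n ∸ 1)) -ℤ + (m C n)
  where m = 2 * n ∸ r ∸ 1

binomΔ : ℕ → ℕ → ℤ
binomΔ m x = + (m C x) -ℤ + (m C suc x)

ballot-suc : ∀ x r → ballot (suc x) r ≡ binomΔ (suc x + suc x ∸ suc r) x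
ballot-suc x r = cong (λ m → binomΔ m x) (2*n∸r∸1≡n+n∸[1+r] (suc x))
  where
  open ≡-Reasoning
  2*n∸r∸1≡n+n∸[1+r] : ∀ n → 2 * n ∸ r ∸ 1 ≡ n + n ∸ suc r
  2*n∸r∸1≡n+n∸[1+r] n = begin
    2 * n ∸ r ∸ 1   ≡⟨ ∸-+-assoc (2 * n) r 1 ⟩
    2 * n ∸ (r + 1) ≡⟨ cong₂ _∸_ (cong (λ m → n + m) (+-identityʳ n)) (+-comm r 1) ⟩
    n + n ∸ suc r   ∎

binomΔ-pascal : ∀ t a → binomΔ (suc t) (suc a) ≡ binomΔ t a +ℤ binomΔ t (suc a)
binomΔ-pascal t a = begin
  + (suc t C suc a) -ℤ + (suc t C 2+ a)
    ≡⟨ cong₂ (λ u v → + u -ℤ + v) (sym (nCk+nC[k+1]≡[n+1]C[k+1] t a)) (sym (nCk+nC[k+1]≡[n+1]C[k+1] t (suc a))) ⟩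
  + (t C a + t C suc a) -ℤ + (t C suc a + t C 2+ a)
    ≡⟨ cong₂ _-ℤ_ (ℤ.pos-+ (t C a) (t C suc a)) (ℤ.pos-+ (t C suc a) (t C 2+ a)) ⟩
  (+ (t C a) +ℤ + (t C suc a)) -ℤ (+ (t C suc a) +ℤ + (t C 2+ a))
    ≡⟨ telescope (+ (t C a)) (+ (t C suc a)) (+ (t C 2+ a)) ⟩
  binomΔ t a +ℤ binomΔ t (suc a) ∎
  where
  open ≡-Reasoning
  telescope : ∀ x y z → (x +ℤ y) -ℤ (y +ℤ z) ≡ (x -ℤ y) +ℤ (y -ℤ z)
  telescope = solve-∀

ballot-pascal : ∀ x b → b ≤ x → ballot (suc x) (suc b) ≡ ballot x b +ℤ ballot (suc x) (2+ b)
ballot-pascal zero .zero z≤n = refl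
ballot-pascal (suc a) b b≤1+a = begin
  ballot (2+ a) (suc b)                           ≡⟨ ballot-suc (suc a) (suc b) ⟩
  binomΔ (a + 2+ a ∸ b) (suc a)                   ≡⟨ cong (λ m → binomΔ (m ∸ b) (suc a)) (+-suc a (suc a)) ⟩
  binomΔ (suc (a + suc a) ∸ b) (suc a)            ≡⟨ cong (λ m → binomΔ m (suc a)) (+-∸-assoc 1 b≤2a+1) ⟩
  binomΔ (suc (a + suc a ∸ b)) (suc a)            ≡⟨ binomΔ-pascal (a + suc a ∸ b) a ⟩
  binomΔ (a + suc a ∸ b) a +ℤ binomΔ (a + suc a ∸ b) (suc a)
    ≡⟨ cong₂ _+ℤ_ (sym (ballot-suc a b)) (cong (λ m → binomΔ (m ∸ suc b) (suc a)) (sym (+-suc a (suc a)))) ⟩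
  ballot (suc a) b +ℤ binomΔ (a + 2+ a ∸ suc b) (suc a) ≡⟨ cong (ballot (suc a) b +ℤ_) (sym (ballot-suc (suc a) (2+ b))) ⟩
  ballot (suc a) b +ℤ ballot (2+ a) (2+ b)         ∎
  where
  open ≡-Reasoning
  b≤2a+1 : b ≤ a + suc a
  b≤2a+1 = ≤-trans b≤1+a (m≤n+m (suc a) a)

ballot-diag : ∀ x → ballot (suc x) (suc x) ≡ + 1
ballot-diag x = begin
  ballot (suc x) (suc x)            ≡⟨ ballot-suc x (suc x) ⟩
  binomΔ (x + suc x ∸ suc x) x      ≡⟨ cong (λ m → binomΔ m x) (m+n∸n≡m x (suc x)) ⟩
  + (x C x) -ℤ + (x C suc x)         ≡⟨ cong₂ (λ u v → + u -ℤ + v) (nCn≡1 x) (k>n⇒nCk≡0 (n<1+n x)) ⟩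
  + 1                               ∎
  where open ≡-Reasoning

ballot-zero : ∀ x → ballot (suc x) 0 ≡ + 0
ballot-zero x = begin
  ballot (suc x) 0                  ≡⟨ ballot-suc x 0 ⟩
  + (m C x) -ℤ + (m C suc x)         ≡⟨ cong (λ u → + u -ℤ + (m C suc x)) (nCk≡nC[n∸k] (m≤m+n x (suc x))) ⟩
  + (m C (m ∸ x)) -ℤ + (m C suc x)   ≡⟨ cong (λ u → + (m C u) -ℤ + (m C suc x)) (m+n∸m≡n x (suc x)) ⟩
  + (m C suc x) -ℤ + (m C suc x)     ≡⟨ ℤ.+-inverseʳ (+ (m C suc x)) ⟩
  + 0                               ∎
  where
  open ≡-Reasoning
  m = x + suc x

-- Needs n ≥ 2: for n = 1 truncated subtraction makes ballot 1 r = 1 for every r.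
ballot-vanish : ∀ x r → 2+ x < r → ballot (2+ x) r ≡ + 0
ballot-vanish x r 2+x<r = begin
  ballot (2+ x) r                   ≡⟨ ballot-suc (suc x) r ⟩
  + (m C suc x) -ℤ + (m C 2+ x)      ≡⟨ cong₂ (λ u v → + u -ℤ + v) (k>n⇒nCk≡0 m<1+x) (k>n⇒nCk≡0 (m<n⇒m<1+n m<1+x)) ⟩
  + 0                               ∎
  where
  open ≡-Reasoning
  m = 2+ x + 2+ x ∸ suc r
  [2+x]+[2+x]≡x+[4+x] : 2+ x + 2+ x ≡ x + (4 + x)
  [2+x]+[2+x]≡x+[4+x] = sym (trans (+-suc x (3 + x)) (cong suc (+-suc x (2+ x))))
  m<1+x : m < suc x
  m<1+x = s≤s (≤-trans (∸-monoʳ-≤ (2+ x + 2+ x) (s≤s 2+x<r))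
                       (≤-reflexive (trans (cong (_∸ (4 + x)) [2+x]+[2+x]≡x+[4+x]) (m+n∸n≡m x (4 + x)))))

sumUpTo : ℕ → (ℕ → ℤ) → ℤ
sumUpTo L f = sumℤ (applyUpTo f L)

sumℤ-map-upTo : ∀ L f → sumℤ (map f (upTo L)) ≡ sumUpTo L f
sumℤ-map-upTo L f = cong sumℤ (map-applyUpTo (λ k → k) f L)

sumUpTo-cong : ∀ L f g → (∀ k → k < L → f k ≡ g k) → sumUpTo L f ≡ sumUpTo L g
sumUpTo-cong zero f g _ = refl
sumUpTo-cong (suc L) f g f≗g =
  cong₂ _+ℤ_ (f≗g 0 z<s) (sumUpTo-cong L _ _ (λ k k<L → f≗g (suc k) (s<s k<L)))

sumUpTo-distrib-+ : ∀ L f g → sumUpTo L (λ k → f k +ℤ g k) ≡ sumUpTo L f +ℤ sumUpTo L g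
sumUpTo-distrib-+ zero f g = refl
sumUpTo-distrib-+ (suc L) f g =
  trans (cong (f 0 +ℤ g 0 +ℤ_) (sumUpTo-distrib-+ L _ _)) (interchange (f 0) (g 0) _ _)
  where
  interchange : ∀ a b c d → (a +ℤ b) +ℤ (c +ℤ d) ≡ (a +ℤ c) +ℤ (b +ℤ d)
  interchange = solve-∀

sumUpTo-vanishing-tail : ∀ L₀ L f → L₀ ≤ L → (∀ k → L₀ ≤ k → k < L → f k ≡ + 0) → sumUpTo L f ≡ sumUpTo L₀ f
sumUpTo-vanishing-tail zero zero f _ _ = refl
sumUpTo-vanishing-tail zero (suc L) f _ f≡0 =
  cong₂ _+ℤ_ (f≡0 0 z≤n z<s) (sumUpTo-vanishing-tail zero L _ z≤n (λ k _ k<L → f≡0 (suc k) z≤n (s<s k<L)))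
sumUpTo-vanishing-tail (suc L₀) (suc L) f (s≤s L₀≤L) f≡0 =
  cong (f 0 +ℤ_) (sumUpTo-vanishing-tail L₀ L _ L₀≤L (λ k L₀≤k k<L → f≡0 (suc k) (s≤s L₀≤k) (s<s k<L)))

module BallotSum (q-1 : ℕ) where

  q : ℕ
  q = suc q-1

  ballotSum : ℕ → ℕ → ℤ
  ballotSum M W = sumUpTo (suc (M / q)) (λ k → ballot (M + W) (k * q + W))

  ballotSum-closedForm : ∀ p n → p ≤ n →
    ballotSum (n ∸ p) p ≡ sumℤ (map (term p q n) (upTo (suc ((n ∸ p) / q))))
  ballotSum-closedForm p n p≤n =
    trans (cong (λ m → sumUpTo L (λ k → ballot m (k * q + p))) (m∸n+n≡m p≤n))
          (sym (sumℤ-map-upTo L (term p q n)))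
    where L = suc ((n ∸ p) / q)

  ballotSum-empty : ∀ w → ballotSum 0 (suc w) ≡ + 1
  ballotSum-empty w = cong (_+ℤ + 0) (ballot-diag w)

  ballotSum-short : ∀ M → suc M < q → ballotSum (suc M) 0 ≡ + 0
  ballotSum-short M 1+M<q rewrite m<n⇒m/n≡0 1+M<q =
    cong (_+ℤ + 0) (trans (cong (λ n → ballot n 0) (+-identityʳ (suc M))) (ballot-zero M))

  ballotSum-restart : ∀ M → q ≤ suc M → ballotSum (suc M) 0 ≡ ballotSum (suc M ∸ q) q
  ballotSum-restart M q≤1+M = begin
    sumUpTo (suc (suc M / q)) f
      ≡⟨ cong (λ L → sumUpTo (suc L) f) (m/n≡1+[m∸n]/n q≤1+M) ⟩
    f 0 +ℤ sumUpTo (suc ((suc M ∸ q) / q)) (λ k → f (suc k))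
      ≡⟨ cong₂ _+ℤ_ f0≡0 (sumUpTo-cong (suc ((suc M ∸ q) / q)) _ _ (λ k _ → f[1+k] k)) ⟩
    + 0 +ℤ ballotSum (suc M ∸ q) q
      ≡⟨ ℤ.+-identityˡ _ ⟩
    ballotSum (suc M ∸ q) q ∎
    where
    open ≡-Reasoning
    f : ℕ → ℤ
    f k = ballot (suc M + 0) (k * q + 0)
    f0≡0 : f 0 ≡ + 0
    f0≡0 = trans (cong (λ n → ballot n 0) (+-identityʳ (suc M))) (ballot-zero M)
    f[1+k] : ∀ k → f (suc k) ≡ ballot (suc M ∸ q + q) (k * q + q)
    f[1+k] k = cong₂ ballot (trans (+-identityʳ (suc M)) (sym (m∸n+n≡m q≤1+M)))
                            (trans (+-identityʳ (suc k * q)) (+-comm q (k * q)))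

  k<1+M/q⇒k*q≤M : ∀ M k → k < suc (M / q) → k * q ≤ M
  k<1+M/q⇒k*q≤M M k (s≤s k≤M/q) = ≤-trans (*-monoˡ-≤ q k≤M/q) (m/n*n≤m M q)

  M/q<k⇒M<k*q : ∀ M k → suc (M / q) ≤ k → M < k * q
  M/q<k⇒M<k*q M k M/q<k with <-≤-connex M (k * q)
  ... | inj₁ M<kq = M<kq
  ... | inj₂ kq≤M = ⊥-elim (<⇒≱ M/q<k (subst (_≤ M / q) (m*n/n≡m k q) (/-monoˡ-≤ q kq≤M)))

  -- Termwise Pascal; the second sum has one term more than ballotSum M (2+ W), but it is 0.
  ballotSum-step : ∀ M W → ballotSum (suc M) (suc W) ≡ ballotSum M (2+ W) +ℤ ballotSum (suc M) W
  ballotSum-step M W = begin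
    ballotSum (suc M) (suc W)       ≡⟨ sumUpTo-cong L _ _ pascal ⟩
    sumUpTo L (λ k → h k +ℤ g k)     ≡⟨ sumUpTo-distrib-+ L h g ⟩
    sumUpTo L h +ℤ sumUpTo L g       ≡⟨ cong (sumUpTo L h +ℤ_) (sumUpTo-vanishing-tail (suc (M / q)) L g L₀≤L g≡0) ⟩
    ballotSum (suc M) W +ℤ ballotSum M (2+ W) ≡⟨ ℤ.+-comm (ballotSum (suc M) W) _ ⟩
    ballotSum M (2+ W) +ℤ ballotSum (suc M) W ∎
    where
    open ≡-Reasoning
    L = suc (suc M / q)
    h g : ℕ → ℤ
    h k = ballot (suc M + W) (k * q + W)
    g k = ballot (M + 2+ W) (k * q + 2+ W)
    L₀≤L : suc (M / q) ≤ L
    L₀≤L = s≤s (/-monoˡ-≤ q (n≤1+n M))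
    M+2+W≡2+M+W : M + 2+ W ≡ 2+ (M + W)
    M+2+W≡2+M+W = trans (+-suc M (suc W)) (cong suc (+-suc M W))
    pascal : ∀ k → k < L → ballot (suc M + suc W) (k * q + suc W) ≡ h k +ℤ g k
    pascal k k<L = begin
      ballot (suc M + suc W) (k * q + suc W)        ≡⟨ cong (ballot (suc M + suc W)) (+-suc (k * q) W) ⟩
      ballot (suc (M + suc W)) (suc (k * q + W))    ≡⟨ ballot-pascal (M + suc W) (k * q + W) kq+W≤M+1+W ⟩
      ballot (M + suc W) (k * q + W) +ℤ ballot (suc (M + suc W)) (2+ (k * q + W))
        ≡⟨ cong₂ _+ℤ_ (cong (λ n → ballot n (k * q + W)) (+-suc M W))
                     (cong₂ ballot (sym (+-suc M (suc W)))
                                   (sym (trans (+-suc (k * q) (suc W)) (cong suc (+-suc (k * q) W))))) ⟩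
      h k +ℤ g k                                     ∎
      where
      kq+W≤M+1+W : k * q + W ≤ M + suc W
      kq+W≤M+1+W = subst (k * q + W ≤_) (sym (+-suc M W)) (+-monoˡ-≤ W (k<1+M/q⇒k*q≤M (suc M) k k<L))
    g≡0 : ∀ k → suc (M / q) ≤ k → k < L → g k ≡ + 0
    g≡0 k M/q<k _ = trans (cong (λ n → ballot n (k * q + 2+ W)) M+2+W≡2+M+W) (ballot-vanish (M + W) _ 2+M+W<kq+2+W)
      where
      2+M+W<kq+2+W : 2+ (M + W) < k * q + 2+ W
      2+M+W<kq+2+W = subst (_< k * q + 2+ W) M+2+W≡2+M+W (+-monoˡ-< (2+ W) (M/q<k⇒M<k*q M k M/q<k))

Steps : ∀ {m} → Vec ℕ m → Set
Steps {m} ω = ∀ (j k : Fin m) → toℕ k ≡ suc (toℕ j) → lookup ω k ≤ suc (lookup ω j)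

ZeroCond : ℕ → ∀ {m} → Vec ℕ m → Fin m → Set
ZeroCond q {m} ω j = (toℕ j + q ≤ m) ×
  (∀ (k : Fin m) → toℕ j < toℕ k → toℕ k < toℕ j + q → lookup ω k ≡ toℕ k ∸ toℕ j)

Steps-tail : ∀ {m x} {xs : Vec ℕ m} → Steps (x ∷ xs) → Steps xs
Steps-tail steps j k k≡1+j = steps (suc j) (suc k) (cong suc k≡1+j)

Steps-cons : ∀ {m x} {xs : Vec ℕ m} → (∀ k → toℕ k ≡ 0 → lookup xs k ≤ suc x) → Steps xs → Steps (x ∷ xs)
Steps-cons head≤ steps zero    (suc k) k≡1 = head≤ k (suc-injective k≡1)
Steps-cons head≤ steps (suc j) (suc k) k≡1+j = steps j k (suc-injective k≡1+j)

ZeroCond-tail : ∀ {q m x} {xs : Vec ℕ m} j → ZeroCond q (x ∷ xs) (suc j) → ZeroCond q xs j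
ZeroCond-tail j (s≤s fits , block) = fits , λ k j<k k<j+q → block (suc k) (s<s j<k) (s<s k<j+q)

ZeroCond-cons : ∀ {q m x} {xs : Vec ℕ m} j → ZeroCond q xs j → ZeroCond q (x ∷ xs) (suc j)
ZeroCond-cons {q} {x = x} {xs} j (fits , block) = s≤s fits , block′
  where
  block′ : ∀ k → suc (toℕ j) < toℕ k → toℕ k < suc (toℕ j) + q → lookup (x ∷ xs) k ≡ toℕ k ∸ suc (toℕ j)
  block′ (suc k) (s<s j<k) (s<s k<j+q) = block k j<k k<j+q

module Tails (q-1 : ℕ) where

  open BallotSum q-1 public

  -- Tail w d: at most w for the next letter, the next d letters forced to be w, w+1, ….
  data Tail : ∀ {m} → ℕ → ℕ → Vec ℕ m → Set where
    end      : ∀ {w} → Tail w 0 []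
    forced   : ∀ {m w d} {xs : Vec ℕ m} → Tail (suc w) d xs → Tail w (suc d) (w ∷ xs)
    restart  : ∀ {m w} {xs : Vec ℕ m} → Tail 1 q-1 xs → Tail w 0 (0 ∷ xs)
    positive : ∀ {m w x} {xs : Vec ℕ m} → 1 ≤ x → x ≤ w → Tail (suc x) 0 xs → Tail w 0 (x ∷ xs)

  tails : ∀ m → ℕ → ℕ → List (Vec ℕ m)
  tails zero    w       zero    = [] ∷ᴸ []ᴸ
  tails zero    w       (suc d) = []ᴸ
  tails (suc m) w       (suc d) = map (w ∷_) (tails m (suc w) d)
  tails (suc m) zero    zero    = map (0 ∷_) (tails m 1 q-1)
  tails (suc m) (suc w) zero    = map (suc w ∷_) (tails m (2+ w) 0) ++ tails (suc m) w 0

  Tail-weaken : ∀ {m w x} {xs : Vec ℕ m} → Tail w 0 (x ∷ xs) → Tail (suc w) 0 (x ∷ xs)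
  Tail-weaken (restart t)            = restart t
  Tail-weaken (positive 1≤x x≤w t)   = positive 1≤x (m≤n⇒m≤1+n x≤w) t

  Tail-head≤ : ∀ {m w x} {xs : Vec ℕ m} → Tail w 0 (x ∷ xs) → x ≤ w
  Tail-head≤ (restart _)            = z≤n
  Tail-head≤ (positive _ x≤w _)     = x≤w

  ∈-tails⇒Tail : ∀ m w d {ω : Vec ℕ m} → ω ∈ tails m w d → Tail w d ω
  ∈-tails⇒Tail zero w zero (here refl) = end
  ∈-tails⇒Tail (suc m) w (suc d) ω∈ with ∈-map⁻ (w ∷_) ω∈
  ... | xs , xs∈ , refl = forced (∈-tails⇒Tail m (suc w) d xs∈)
  ∈-tails⇒Tail (suc m) zero zero ω∈ with ∈-map⁻ (0 ∷_) ω∈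
  ... | xs , xs∈ , refl = restart (∈-tails⇒Tail m 1 q-1 xs∈)
  ∈-tails⇒Tail (suc m) (suc w) zero ω∈ with ∈-++⁻ (map (suc w ∷_) (tails m (2+ w) 0)) ω∈
  ... | inj₁ ω∈′ with ∈-map⁻ (suc w ∷_) ω∈′
  ...   | xs , xs∈ , refl = positive z<s ≤-refl (∈-tails⇒Tail m (2+ w) zero xs∈)
  ∈-tails⇒Tail (suc m) (suc w) zero {_ ∷ _} ω∈ | inj₂ ω∈′ = Tail-weaken (∈-tails⇒Tail (suc m) w zero ω∈′)

  ∈-tails-restart : ∀ {m w} {xs : Vec ℕ m} → xs ∈ tails m 1 q-1 → (0 ∷ xs) ∈ tails (suc m) w 0
  ∈-tails-restart {w = zero}      xs∈ = ∈-map⁺ _ xs∈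
  ∈-tails-restart {m} {suc w}     xs∈ = ∈-++⁺ʳ (map (suc w ∷_) (tails m (2+ w) 0)) (∈-tails-restart {w = w} xs∈)

  ∈-tails-positive : ∀ {m w x} {xs : Vec ℕ m} → 1 ≤ x → x ≤ w → xs ∈ tails m (suc x) 0 → (x ∷ xs) ∈ tails (suc m) w 0
  ∈-tails-positive {w = zero} 1≤x x≤0 _ = ⊥-elim (<⇒≱ 1≤x x≤0)
  ∈-tails-positive {m} {suc w} 1≤x x≤1+w xs∈ with m≤n⇒m<n∨m≡n x≤1+w
  ... | inj₂ refl  = ∈-++⁺ˡ (∈-map⁺ _ xs∈)
  ... | inj₁ x<1+w = ∈-++⁺ʳ (map (suc w ∷_) (tails m (2+ w) 0)) (∈-tails-positive {w = w} 1≤x (s≤s⁻¹ x<1+w) xs∈)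

  Tail⇒∈-tails : ∀ {m w d} {ω : Vec ℕ m} → Tail w d ω → ω ∈ tails m w d
  Tail⇒∈-tails end                  = here refl
  Tail⇒∈-tails (forced t)           = ∈-map⁺ _ (Tail⇒∈-tails t)
  Tail⇒∈-tails {w = w} (restart t)  = ∈-tails-restart {w = w} (Tail⇒∈-tails t)
  Tail⇒∈-tails (positive 1≤x x≤w t) = ∈-tails-positive 1≤x x≤w (Tail⇒∈-tails t)

  tails-unique : ∀ m w d → Unique (tails m w d)
  tails-unique zero    w       zero    = All.[] AllPairs.∷ AllPairs.[]
  tails-unique zero    w       (suc d) = AllPairs.[]
  tails-unique (suc m) w       (suc d) = Unique.map⁺ ∷-injectiveʳ (tails-unique m (suc w) d)
  tails-unique (suc m) zero    zero    = Unique.map⁺ ∷-injectiveʳ (tails-unique m 1 q-1)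
  tails-unique (suc m) (suc w) zero    =
    Unique.++⁺ (Unique.map⁺ ∷-injectiveʳ (tails-unique m (2+ w) 0)) (tails-unique (suc m) w 0) disjoint
    where
    disjoint : Disjoint (map (suc w ∷_) (tails m (2+ w) 0)) (tails (suc m) w 0)
    disjoint (ω∈ˡ , ω∈ʳ) with ∈-map⁻ (suc w ∷_) ω∈ˡ
    ... | _ , _ , refl = <⇒≱ (n<1+n w) (Tail-head≤ (∈-tails⇒Tail (suc m) w zero ω∈ʳ))

  length-tails-short : ∀ m w d → m < d → length (tails m w d) ≡ 0
  length-tails-short zero    w (suc d) _ = refl
  length-tails-short (suc m) w (suc d) (s<s m<d) =
    trans (length-map (w ∷_) (tails m (suc w) d)) (length-tails-short m (suc w) d m<d)

  -- For m = w = 0 the single empty tail is not counted by ballotSum 0 0 = 0: this is where n ≥ 1 enters.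
  length-tails : ∀ m w d → d ≤ m → 1 ≤ m + w → + length (tails m w d) ≡ ballotSum (m ∸ d) (w + d)
  length-tails zero (suc w) zero _ _ = sym (trans (cong (ballotSum 0) (+-identityʳ (suc w))) (ballotSum-empty w))
  length-tails (suc m) w (suc d) (s≤s d≤m) _ = begin
    + length (map (w ∷_) (tails m (suc w) d)) ≡⟨ cong +_ (length-map (w ∷_) (tails m (suc w) d)) ⟩
    + length (tails m (suc w) d)              ≡⟨ length-tails m (suc w) d d≤m (subst (1 ≤_) (sym (+-suc m w)) z<s) ⟩
    ballotSum (m ∸ d) (suc w + d)             ≡⟨ cong (ballotSum (m ∸ d)) (sym (+-suc w d)) ⟩
    ballotSum (m ∸ d) (w + suc d)             ∎
    where open ≡-Reasoning
  length-tails (suc m) zero zero _ _ with <-≤-connex m q-1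
  ... | inj₁ m<q-1 = begin
    + length (map (0 ∷_) (tails m 1 q-1))     ≡⟨ cong +_ (length-map (0 ∷_) (tails m 1 q-1)) ⟩
    + length (tails m 1 q-1)                  ≡⟨ cong +_ (length-tails-short m 1 q-1 m<q-1) ⟩
    + 0                                       ≡⟨ sym (ballotSum-short m (s<s m<q-1)) ⟩
    ballotSum (suc m) 0                       ∎
    where open ≡-Reasoning
  ... | inj₂ q-1≤m = begin
    + length (map (0 ∷_) (tails m 1 q-1))     ≡⟨ cong +_ (length-map (0 ∷_) (tails m 1 q-1)) ⟩
    + length (tails m 1 q-1)                  ≡⟨ length-tails m 1 q-1 q-1≤m (subst (1 ≤_) (+-comm 1 m) z<s) ⟩
    ballotSum (m ∸ q-1) q                     ≡⟨ sym (ballotSum-restart m (s≤s q-1≤m)) ⟩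
    ballotSum (suc m) 0                       ∎
    where open ≡-Reasoning
  length-tails (suc m) (suc w) zero _ _ = begin
    + length (map (suc w ∷_) (tails m (2+ w) 0) ++ tails (suc m) w 0)
      ≡⟨ cong +_ (length-++ (map (suc w ∷_) (tails m (2+ w) 0))) ⟩
    + (length (map (suc w ∷_) (tails m (2+ w) 0)) + length (tails (suc m) w 0))
      ≡⟨ ℤ.pos-+ (length (map (suc w ∷_) (tails m (2+ w) 0))) (length (tails (suc m) w 0)) ⟩
    + length (map (suc w ∷_) (tails m (2+ w) 0)) +ℤ + length (tails (suc m) w 0)
      ≡⟨ cong₂ _+ℤ_ (trans (cong +_ (length-map (suc w ∷_) (tails m (2+ w) 0)))
                          (length-tails m (2+ w) 0 z≤n (subst (1 ≤_) (sym (+-suc m (suc w))) z<s)))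
                   (length-tails (suc m) w 0 z≤n z<s) ⟩
    ballotSum m (2+ w + 0) +ℤ ballotSum (suc m) (w + 0)
      ≡⟨ cong₂ (λ a b → ballotSum m a +ℤ ballotSum (suc m) b) (+-identityʳ (2+ w)) (+-identityʳ w) ⟩
    ballotSum m (2+ w) +ℤ ballotSum (suc m) w  ≡⟨ sym (ballotSum-step m w) ⟩
    ballotSum (suc m) (suc w)                 ≡⟨ cong (ballotSum (suc m)) (sym (+-identityʳ (suc w))) ⟩
    ballotSum (suc m) (suc w + 0)             ∎
    where open ≡-Reasoning

  -- FineWord p q n, generalised to an arbitrary state (w, d) of Tail.
  record FineTail {m} (w d : ℕ) (ω : Vec ℕ m) : Set where
    field
      prefix      : ∀ j → toℕ j < d → lookup ω j ≡ w + toℕ j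
      prefix-fits : d ≤ m
      head-bound  : ∀ j → toℕ j ≡ 0 → d ≡ 0 → lookup ω j ≤ w
      step        : Steps ω
      zero-cond   : ∀ j → d ≤ toℕ j → lookup ω j ≡ 0 → ZeroCond q ω j
  open FineTail

  FineTail-head≤ : ∀ {m w d} {ω : Vec ℕ m} → FineTail w d ω → ∀ j → toℕ j ≡ 0 → lookup ω j ≤ w
  FineTail-head≤ {w = w} {zero}  t j j≡0 = head-bound t j j≡0 refl
  FineTail-head≤ {w = w} {suc d} t zero _ = ≤-reflexive (trans (prefix t zero z<s) (+-identityʳ w))

  FineTail-forced⁻ : ∀ {m w d x} {xs : Vec ℕ m} → FineTail w (suc d) (x ∷ xs) → x ≡ w × FineTail (suc w) d xs
  FineTail-forced⁻ {w = w} {xs = xs} t = x≡w , record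
    { prefix      = λ j j<d → trans (prefix t (suc j) (s<s j<d)) (+-suc w (toℕ j))
    ; prefix-fits = s≤s⁻¹ (prefix-fits t)
    ; head-bound  = λ { zero _ _ → subst (λ y → lookup xs zero ≤ suc y) x≡w (step t zero (suc zero) refl) }
    ; step        = Steps-tail (step t)
    ; zero-cond   = λ j d≤j xs[j]≡0 → ZeroCond-tail j (zero-cond t (suc j) (s≤s d≤j) xs[j]≡0)
    }
    where x≡w = trans (prefix t zero z<s) (+-identityʳ w)

  FineTail-restart⁻ : ∀ {m w} {xs : Vec ℕ m} → FineTail w 0 (0 ∷ xs) → FineTail 1 q-1 xs
  FineTail-restart⁻ t = record
    { prefix      = λ j j<q-1 → proj₂ block (suc j) z<s (s<s j<q-1)
    ; prefix-fits = s≤s⁻¹ (proj₁ block)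
    ; head-bound  = λ { zero _ _ → step t zero (suc zero) refl }
    ; step        = Steps-tail (step t)
    ; zero-cond   = λ j _ xs[j]≡0 → ZeroCond-tail j (zero-cond t (suc j) z≤n xs[j]≡0)
    }
    where block = zero-cond t zero z≤n refl

  FineTail-positive⁻ : ∀ {m w x} {xs : Vec ℕ m} → FineTail w 0 (x ∷ xs) → FineTail (suc x) 0 xs
  FineTail-positive⁻ t = record
    { prefix      = λ _ ()
    ; prefix-fits = z≤n
    ; head-bound  = λ { zero _ _ → step t zero (suc zero) refl }
    ; step        = Steps-tail (step t)
    ; zero-cond   = λ j _ xs[j]≡0 → ZeroCond-tail j (zero-cond t (suc j) z≤n xs[j]≡0)
    }

  FineTail⇒Tail : ∀ {m w d} (ω : Vec ℕ m) → FineTail w d ω → Tail w d ω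
  FineTail⇒Tail {d = zero}  []            _ = end
  FineTail⇒Tail {d = suc d} []            t = ⊥-elim (<⇒≱ z<s (prefix-fits t))
  FineTail⇒Tail {d = suc d} (x ∷ xs)      t with FineTail-forced⁻ t
  ... | refl , t′ = forced (FineTail⇒Tail xs t′)
  FineTail⇒Tail {d = zero}  (zero ∷ xs)   t = restart (FineTail⇒Tail xs (FineTail-restart⁻ t))
  FineTail⇒Tail {d = zero}  (suc x ∷ xs)  t =
    positive z<s (head-bound t zero refl refl) (FineTail⇒Tail xs (FineTail-positive⁻ t))

  FineTail-[] : ∀ {w} → FineTail w 0 []
  FineTail-[] = record { prefix = λ () ; prefix-fits = z≤n ; head-bound = λ () ; step = λ () ; zero-cond = λ () }

  FineTail-forced⁺ : ∀ {m w d} {xs : Vec ℕ m} → FineTail (suc w) d xs → FineTail w (suc d) (w ∷ xs)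
  FineTail-forced⁺ {w = w} {xs = xs} t = record
    { prefix      = prefix′
    ; prefix-fits = s≤s (prefix-fits t)
    ; head-bound  = λ _ _ ()
    ; step        = Steps-cons (FineTail-head≤ t) (step t)
    ; zero-cond   = λ { (suc j) (s≤s d≤j) xs[j]≡0 → ZeroCond-cons j (zero-cond t j d≤j xs[j]≡0) }
    }
    where
    prefix′ : ∀ j → toℕ j < _ → lookup (w ∷ xs) j ≡ w + toℕ j
    prefix′ zero    _         = sym (+-identityʳ w)
    prefix′ (suc j) (s<s j<d) = trans (prefix t j j<d) (sym (+-suc w (toℕ j)))

  FineTail-restart⁺ : ∀ {m w} {xs : Vec ℕ m} → FineTail 1 q-1 xs → FineTail w 0 (0 ∷ xs)
  FineTail-restart⁺ {xs = xs} t = record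
    { prefix      = λ _ ()
    ; prefix-fits = z≤n
    ; head-bound  = λ { zero _ _ → z≤n }
    ; step        = Steps-cons (FineTail-head≤ t) (step t)
    ; zero-cond   = zero-cond′
    }
    where
    block : ∀ k → 0 < toℕ k → toℕ k < q → lookup (0 ∷ xs) k ≡ toℕ k
    block (suc k) _ (s<s k<q-1) = prefix t k k<q-1
    zero-cond′ : ∀ j → 0 ≤ toℕ j → lookup (0 ∷ xs) j ≡ 0 → ZeroCond q (0 ∷ xs) j
    zero-cond′ zero    _ _ = s≤s (prefix-fits t) , block
    zero-cond′ (suc j) _ xs[j]≡0 with <-≤-connex (toℕ j) q-1
    ... | inj₁ j<q-1 = ⊥-elim (1+n≢0 (trans (sym (prefix t j j<q-1)) xs[j]≡0))
    ... | inj₂ q-1≤j = ZeroCond-cons j (zero-cond t j q-1≤j xs[j]≡0)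

  FineTail-positive⁺ : ∀ {m w x} {xs : Vec ℕ m} → 1 ≤ x → x ≤ w → FineTail (suc x) 0 xs → FineTail w 0 (x ∷ xs)
  FineTail-positive⁺ 1≤x x≤w t = record
    { prefix      = λ _ ()
    ; prefix-fits = z≤n
    ; head-bound  = λ { zero _ _ → x≤w }
    ; step        = Steps-cons (FineTail-head≤ t) (step t)
    ; zero-cond   = λ { zero _ x≡0 → ⊥-elim (<⇒≱ 1≤x (≤-reflexive x≡0))
                      ; (suc j) _ xs[j]≡0 → ZeroCond-cons j (zero-cond t j z≤n xs[j]≡0) }
    }

  Tail⇒FineTail : ∀ {m w d} {ω : Vec ℕ m} → Tail w d ω → FineTail w d ω
  Tail⇒FineTail end                  = FineTail-[]
  Tail⇒FineTail (forced t)           = FineTail-forced⁺ (Tail⇒FineTail t)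
  Tail⇒FineTail (restart t)          = FineTail-restart⁺ (Tail⇒FineTail t)
  Tail⇒FineTail (positive 1≤x x≤w t) = FineTail-positive⁺ 1≤x x≤w (Tail⇒FineTail t)

  FineWord⇒FineTail : ∀ {p n} {ω : Vec ℕ n} → p ≤ n → FineWord p q n ω → FineTail 0 p ω
  FineWord⇒FineTail p≤n fw = record
    { prefix      = FineWord.prefix fw
    ; prefix-fits = p≤n
    ; head-bound  = λ j j≡0 _ → ≤-reflexive (FineWord.first-zero fw j j≡0)
    ; step        = FineWord.step fw
    ; zero-cond   = FineWord.zero-cond fw
    }

  FineTail⇒FineWord : ∀ {p n} {ω : Vec ℕ n} → FineTail 0 p ω → FineWord p q n ω
  FineTail⇒FineWord t = record
    { first-zero = λ j j≡0 → n≤0⇒n≡0 (FineTail-head≤ t j j≡0)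
    ; prefix     = prefix t
    ; step       = step t
    ; zero-cond  = zero-cond t
    }

  ∈-tails⇔FineWord : ∀ {p n} {ω : Vec ℕ n} → p ≤ n → (ω ∈ tails n 0 p) ⇔ FineWord p q n ω
  ∈-tails⇔FineWord {p} {n} {ω} p≤n = mk⇔
    (λ ω∈ → FineTail⇒FineWord (Tail⇒FineTail (∈-tails⇒Tail n 0 p ω∈)))
    (λ fw → Tail⇒∈-tails (FineTail⇒Tail ω (FineWord⇒FineTail p≤n fw)))

mainTheorem1 : (p q n : ℕ) → .{{_ : NonZero q}} → p < q → (p ⊔ 1) ≤ n →
    Σ ℕ λ N → HasCard {Vec ℕ n} (FineWord p q n) N ×
      (+ N ≡ sumℤ (map (term p q n) (upTo (suc ((n ∸ p) / q)))))
mainTheorem1 p (suc q-1) n _ p⊔1≤n =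
  length ws , (ws , tails-unique n 0 p , (λ _ → ∈-tails⇔FineWord p≤n) , refl) ,
  trans (length-tails n 0 p p≤n 1≤n+0) (ballotSum-closedForm p n p≤n)
  where
  open Tails q-1
  ws = tails n 0 p
  p≤n : p ≤ n
  p≤n = ≤-trans (m≤m⊔n p 1) p⊔1≤n
  1≤n+0 : 1 ≤ n + 0
  1≤n+0 = ≤-trans (m≤n⊔m p 1) (≤-trans p⊔1≤n (m≤m+n n 0))
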